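{- Let $ALG$ be any deterministic online algorithm for the online dominating set problem. For infinitely many values of $n$ there is a threshold graph $G_n$ on $n$ vertices (together with an admissible revelation order) such that the number of vertices selected by $ALG$ on $G_n$ is $\Omega(\sqrt{n})$.
   Context: Online dominating set model: an input is a finite, connected, simple, undirected graph $G=(V,E)$ together with an ordering $v_1,\dots,v_n$ of $V$ chosen by an adversary such that for every $i$ the subgraph induced on $\{v_1,\dots,v_i\}$ is connected (an admissible order). At step $i$, $v_i$ is revealed together with its entire closed neighbourhood $N[v_i]$ (including not yet revealed neighbours), and the algorithm irrevocably decides, before the next step, whether to select $v_i$; the selected set must be a dominating set of $G$. The algorithm does not know $G$ or $n$ in advance. Threshold graphs are defined recursively: $K_1$ is a threshold graph; if $G$ is a threshold graph then so is the disjoint union of $G$ with a new isolated vertex, and so is the join of $G$ with a new vertex (a new vertex adjacent to all vertices of $G$). Every connected threshold graph has a dominating set of size $1$, so performance is measured as a function of $n$. -}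

module Defs where

open import Data.Nat using (ℕ; zero; suc; _+_; _*_; _^_; _≤_; _<_)
open import Data.Nat.Properties using (_<?_)
open import Data.Fin using (Fin; toℕ)
open import Data.Bool using (Bool; true; false; if_then_else_)
open import Data.List using (List; []; _∷_; length; lookup; take; tabulate; map; allFin)
open import Data.Nat.ListAction using (sum)
open import Data.List.Membership.Propositional using (_∈_)
open import Data.Product using (Σ; _×_; _,_)
open import Data.Sum using (_⊎_)
open import Function using (_⇔_; _↔_; Inverse)
open import Relation.Nullary using (yes; no)
open import Relation.Binary.PropositionalEquality using (_≡_)

Adj : ℕ → Set
Adj n = Fin n → Fin n → Bool

Symmetric : ∀ {n} → Adj n → Set
Symmetric {n} a = (i j : Fin n) → a i j ≡ a j i

Irreflexive : ∀ {n} → Adj n → Set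
Irreflexive {n} a = (i : Fin n) → a i i ≡ false

-- Reach k a u v : v is reachable from u by a path all of whose vertices
-- have index < k (the start u is assumed to satisfy this separately).
data Reach {n : ℕ} (k : ℕ) (a : Adj n) (u : Fin n) : Fin n → Set where
  here : Reach k a u u
  step : ∀ {v w} → Reach k a u v → a v w ≡ true → toℕ w < k → Reach k a u w

-- The revelation order is v₀, v₁, …, v_{n-1} (index order in Fin n).
-- Admissible: for every k the subgraph induced on the first k revealed
-- vertices is connected.
Admissible : ∀ {n} → Adj n → Set
Admissible {n} a = (k : ℕ) (u v : Fin n) → toℕ u < k → toℕ v < k → Reach k a u v

-- A construction sequence s : List Bool describes the
-- graph on vertices 0 … length s, where vertex 0 is the initial K₁ and
-- vertex m ≥ 1 is added as an isolated vertex (s[m-1] = false) or as a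
-- vertex joined to all previous vertices (s[m-1] = true).

addedAsJoin : List Bool → ℕ → Bool
addedAsJoin s zero = false
addedAsJoin [] (suc m) = false
addedAsJoin (b ∷ s) (suc zero) = b
addedAsJoin (b ∷ s) (suc (suc m)) = addedAsJoin s (suc m)

thrAdj : (s : List Bool) → Adj (suc (length s))
thrAdj s i j with toℕ i <? toℕ j | toℕ j <? toℕ i
... | yes _ | _     = addedAsJoin s (toℕ j)
... | no _  | yes _ = addedAsJoin s (toℕ i)
... | no _  | no _  = false

Iso : ∀ {n m} → Adj n → Adj m → Set
Iso {n} {m} a b = Σ (Fin n ↔ Fin m) λ f →
  (i j : Fin n) → a i j ≡ b (Inverse.to f i) (Inverse.to f j)

IsThreshold : ∀ {n} → Adj n → Set
IsThreshold a = Σ (List Bool) λ s → Iso a (thrAdj s)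

-- What is revealed at a step: the name of the vertex and the list of
-- names of its closed neighbourhood.
Reveal : Set
Reveal = ℕ × List ℕ

record Instance : Set where
  field
    n        : ℕ
    adj      : Adj n
    sym      : Symmetric adj
    irrefl   : Irreflexive adj
    admissible : Admissible adj
    -- vertex identifiers seen by the algorithm (chosen by the adversary)
    name     : Fin n → ℕ
    name-inj : (i j : Fin n) → name i ≡ name j → i ≡ j
    nbhd     : Fin n → List ℕ
    nbhd-ok  : (i : Fin n) (x : ℕ) →
               (x ∈ nbhd i) ⇔ Σ (Fin n) (λ j → name j ≡ x × (j ≡ i ⊎ adj i j ≡ true))

  reveal : Fin n → Reveal
  reveal i = name i , nbhd i

-- A deterministic online algorithm: given the list of previous reveals
-- (its own previous decisions are determined by these) and the current
-- reveal, decide whether to select the current vertex.  It gets no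
-- knowledge of the graph or of n.
Algorithm : Set
Algorithm = List Reveal → Reveal → Bool

module _ (alg : Algorithm) (I : Instance) where
  open Instance I

  decision : Fin n → Bool
  decision i = alg (take (toℕ i) (tabulate reveal)) (reveal i)

  Dominating : Set
  Dominating = (v : Fin n) → Σ (Fin n) λ u →
    decision u ≡ true × (u ≡ v ⊎ adj u v ≡ true)

  numSelected : ℕ
  numSelected = sum (map (λ i → if decision i then 1 else 0) (allFin n))

Valid : Algorithm → Set
Valid alg = (I : Instance) → Dominating alg I

-- The adversary first reveals t hubs 0, …, t − 1, which form a clique, hub p being joined to
-- every vertex of index at most (p + 1)K; the remaining vertices are leaves.  The closed
-- neighbourhood {0, …, (p + 1)K} of hub p does not mention t, so the algorithm's decision on
-- hub p is the same for every t > p.  If it selects each of the first K hubs, take t = K;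
-- if it rejects hub p, take t = p + 1, so that the K leaves pK + 1, …, (p + 1)K are adjacent to
-- hub p only and must all be selected.  Either way at least K vertices are selected out of
-- n = 1 + tK ≤ 1 + K².  The graph is a threshold graph: listing, for p = 0, 1, …, the leaves
-- joined to hub p but to no earlier hub and then hub p itself, every vertex is adjacent to all
-- or to none of its predecessors.

module Submission where

open import Defs
open import Data.Bool as Bool using (Bool; true; false; if_then_else_)
open import Data.Bool.Properties using (¬-not)
open import Data.Fin as Fin using (Fin; zero; suc; toℕ; fromℕ<; punchOut)
open import Data.Fin.Induction using () renaming (<-wellFounded to <-wellFounded-Fin)
open import Data.Fin.Properties
  using (toℕ-injective; toℕ<n; toℕ-fromℕ<; injective⇒≤; punchOut-injective; any?)
open import Data.List using (List; []; _∷_; _++_; [_]; length; take; tabulate; applyUpTo; upTo; allFin; filter)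
open import Data.List.Properties
  using (length-tabulate; map-tabulate; upTo-∷ʳ; ++-identityʳ;
         filter-++; filter-all; filter-accept; filter-reject; filter-notAll)
open import Data.List.Membership.Propositional using (_∈_)
open import Data.List.Membership.Propositional.Properties
  using (∈-filter⁺; ∈-filter⁻; ∈-upTo⁺; ∈-upTo⁻; ∈-allFin)
open import Data.List.Relation.Unary.All as All using ()
open import Data.List.Relation.Unary.Any as Any using (here; there)
open import Data.Nat
open import Data.Nat.ListAction using (sum)
open import Data.Nat.Properties
open import Data.Nat.Tactic.RingSolver using (solve-∀)
open import Data.Product using (Σ; ∃; _×_; _,_; proj₁; proj₂)
open import Data.Sum using (_⊎_; inj₁; inj₂; swap)
open import Function using (_∘_; _⇔_; mk⇔; _↔_; Inverse; mk↔ₛ′)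
open import Function.Definitions using (Injective)
open import Induction.WellFounded using (Acc; acc)
open import Relation.Binary.Definitions using (tri<; tri≈; tri>)
open import Relation.Binary.PropositionalEquality
  using (_≡_; _≢_; refl; sym; trans; cong; cong₂; subst; subst₂; module ≡-Reasoning)
open import Relation.Nullary using (Dec; yes; no; ¬_; does; contradiction)
open import Relation.Nullary.Decidable using (dec-true; dec-false; ¬?; _×-dec_; _⊎-dec_)
open import Relation.Unary using (Decidable)

private
  variable
    A : Set

module _ {n k : ℕ} {a : Adj n} where

  reach-trans : ∀ {u v w} → Reach k a u v → Reach k a v w → Reach k a u w
  reach-trans r here = r
  reach-trans r (step r′ e w<k) = step (reach-trans r r′) e w<k

  reach-< : ∀ {u v} → toℕ u < k → Reach k a u v → toℕ v < k
  reach-< u<k here = u<k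
  reach-< u<k (step _ _ w<k) = w<k

  reach-sym : Symmetric a → ∀ {u v} → toℕ u < k → Reach k a u v → Reach k a v u
  reach-sym sym u<k here = here
  reach-sym sym u<k (step {v} {w} r e w<k) =
    reach-trans (step here (trans (sym w v) e) (reach-< u<k r)) (reach-sym sym u<k r)

earlierNeighbours⇒admissible : ∀ {n} {a : Adj (suc n)} → Symmetric a →
  (∀ v → 0 < toℕ v → Σ (Fin (suc n)) λ w → toℕ w < toℕ v × a w v ≡ true) →
  Admissible a
earlierNeighbours⇒admissible {n} {a} sym earlier k u v u<k v<k =
  reach-trans (reach-sym sym (≤-<-trans z≤n u<k) (fromZero u (<-wellFounded-Fin u) u<k))
              (fromZero v (<-wellFounded-Fin v) v<k)
  where
  fromZero : ∀ v → Acc Fin._<_ v → toℕ v < k → Reach k a zero v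
  fromZero zero _ _ = here
  fromZero (suc v) (acc rec) v<k with w , w<v , e ← earlier (suc v) z<s =
    step (fromZero w (rec w<v) (<-trans w<v v<k)) e v<k

filter-upTo : ∀ {P : ℕ → Set} (P? : Decidable P) {M} n → M ≤ n →
  (∀ {y} → y < n → P y → y < M) → (∀ {y} → y < M → P y) →
  filter P? (upTo n) ≡ upTo M
filter-upTo P? zero z≤n _ _ = refl
filter-upTo P? {M} (suc n) M≤1+n sound complete with m≤n⇒m<n∨m≡n M≤1+n
... | inj₁ M<1+n = begin
  filter P? (upTo (suc n))              ≡⟨ cong (filter P?) (sym (upTo-∷ʳ n)) ⟩
  filter P? (upTo n ++ [ n ])           ≡⟨ filter-++ P? (upTo n) [ n ] ⟩
  filter P? (upTo n) ++ filter P? [ n ] ≡⟨ cong₂ _++_ (filter-upTo P? n (≤-pred M<1+n) (sound ∘ m<n⇒m<1+n) complete)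
                                                     (filter-reject P? λ Pn → <⇒≱ (sound ≤-refl Pn) (≤-pred M<1+n)) ⟩
  upTo M ++ []                          ≡⟨ ++-identityʳ (upTo M) ⟩
  upTo M                                ∎
  where open ≡-Reasoning
... | inj₂ refl = begin
  filter P? (upTo (suc n))              ≡⟨ cong (filter P?) (sym (upTo-∷ʳ n)) ⟩
  filter P? (upTo n ++ [ n ])           ≡⟨ filter-++ P? (upTo n) [ n ] ⟩
  filter P? (upTo n) ++ filter P? [ n ] ≡⟨ cong₂ _++_ (filter-all P? (All.tabulate (complete ∘ m<n⇒m<1+n ∘ ∈-upTo⁻)))
                                                     (filter-accept P? (complete ≤-refl)) ⟩
  upTo n ++ [ n ]                       ≡⟨ upTo-∷ʳ n ⟩
  upTo (suc n)                          ∎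
  where open ≡-Reasoning

take-tabulate : ∀ {n p} (f g : ℕ → A) → p ≤ n → (∀ {x} → x < p → f x ≡ g x) →
  take p (tabulate {n = n} (f ∘ toℕ)) ≡ applyUpTo g p
take-tabulate {p = zero} f g _ _ = refl
take-tabulate {n = suc n} {p = suc p} f g (s≤s p≤n) f≡g =
  cong₂ _∷_ (f≡g z<s) (take-tabulate (f ∘ suc) (g ∘ suc) p≤n (f≡g ∘ s<s))

module ClosedNeighbourhood (n : ℕ) (edge : ℕ → ℕ → Bool) where

  adj : Adj n
  adj i j = edge (toℕ i) (toℕ j)

  Closed : ℕ → ℕ → Set
  Closed x y = x ≡ y ⊎ edge x y ≡ true

  closed? : ∀ x → Decidable (Closed x)
  closed? x y = (x ≟ y) ⊎-dec (edge x y Bool.≟ true)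

  nbhd : ℕ → List ℕ
  nbhd x = filter (closed? x) (upTo n)

  nbhd-correct : (i : Fin n) (x : ℕ) →
    (x ∈ nbhd (toℕ i)) ⇔ Σ (Fin n) (λ j → toℕ j ≡ x × (j ≡ i ⊎ adj i j ≡ true))
  nbhd-correct i x = mk⇔ to from
    where
    to : x ∈ nbhd (toℕ i) → Σ (Fin n) (λ j → toℕ j ≡ x × (j ≡ i ⊎ adj i j ≡ true))
    to x∈ = fromℕ< x<n , toℕ-fromℕ< x<n , neighbour (proj₂ member)
      where
      member : x ∈ upTo n × Closed (toℕ i) x
      member = ∈-filter⁻ (closed? (toℕ i)) x∈
      x<n : x < n
      x<n = ∈-upTo⁻ (proj₁ member)
      neighbour : Closed (toℕ i) x → fromℕ< x<n ≡ i ⊎ adj i (fromℕ< x<n) ≡ true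
      neighbour (inj₁ i≡x) = inj₁ (toℕ-injective (trans (toℕ-fromℕ< x<n) (sym i≡x)))
      neighbour (inj₂ e)   = inj₂ (subst (λ y → edge (toℕ i) y ≡ true) (sym (toℕ-fromℕ< x<n)) e)
    from : Σ (Fin n) (λ j → toℕ j ≡ x × (j ≡ i ⊎ adj i j ≡ true)) → x ∈ nbhd (toℕ i)
    from (j , refl , inj₁ refl) = ∈-filter⁺ (closed? (toℕ i)) (∈-upTo⁺ (toℕ<n i)) (inj₁ refl)
    from (j , refl , inj₂ e)    = ∈-filter⁺ (closed? (toℕ i)) (∈-upTo⁺ (toℕ<n j)) (inj₂ e)

injective⇒surjective : ∀ {n} {f : Fin n → Fin n} → Injective _≡_ _≡_ f → ∀ y → ∃ λ x → f x ≡ y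
injective⇒surjective {suc n} {f} f-inj y with any? (λ x → f x Fin.≟ y)
... | yes hit = hit
... | no miss = contradiction (injective⇒≤ {f = λ x → punchOut (avoids x)} punchOut∘f-inj) (<-irrefl refl)
  where
  avoids : ∀ x → y ≢ f x
  avoids x y≡fx = miss (x , sym y≡fx)
  punchOut∘f-inj : Injective _≡_ _≡_ (λ x → punchOut (avoids x))
  punchOut∘f-inj eq = f-inj (punchOut-injective (avoids _) (avoids _) eq)

injective⇒↔ : ∀ {n} (f : Fin n → Fin n) → Injective _≡_ _≡_ f → Fin n ↔ Fin n
injective⇒↔ f f-inj = mk↔ₛ′ f (proj₁ ∘ surj) (proj₂ ∘ surj) (λ x → f-inj (proj₂ (surj (f x))))
  where
  surj : ∀ y → ∃ λ x → f x ≡ y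
  surj = injective⇒surjective f-inj

module _ {P Q : A → Set} (P? : Decidable P) (Q? : Decidable Q) (P⇒Q : ∀ {x} → P x → Q x) where

  length-filter-mono-≤ : ∀ xs → length (filter P? xs) ≤ length (filter Q? xs)
  length-filter-mono-≤ [] = z≤n
  length-filter-mono-≤ (x ∷ xs) with P? x | Q? x
  ... | yes _  | yes _   = s≤s (length-filter-mono-≤ xs)
  ... | yes px | no ¬qx  = contradiction (P⇒Q px) ¬qx
  ... | no _   | yes _   = m≤n⇒m≤1+n (length-filter-mono-≤ xs)
  ... | no _   | no _    = length-filter-mono-≤ xs

  length-filter-mono-< : ∀ {x xs} → x ∈ xs → ¬ P x → Q x → length (filter P? xs) < length (filter Q? xs)
  length-filter-mono-< {xs = y ∷ xs} (here refl) ¬py qy with P? y | Q? y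
  ... | yes py | _      = contradiction py ¬py
  ... | no _   | yes _  = s≤s (length-filter-mono-≤ xs)
  ... | no _   | no ¬qy = contradiction qy ¬qy
  length-filter-mono-< {xs = y ∷ xs} (there x∈) ¬px qx with P? y | Q? y
  ... | yes _  | yes _  = s≤s (length-filter-mono-< x∈ ¬px qx)
  ... | yes py | no ¬qy = contradiction (P⇒Q py) ¬qy
  ... | no _   | yes _  = m<n⇒m<1+n (length-filter-mono-< x∈ ¬px qx)
  ... | no _   | no _   = length-filter-mono-< x∈ ¬px qx

module Position {n} (r : Fin n → ℕ) (r-inj : Injective _≡_ _≡_ r) where

  position : Fin n → ℕ
  position i = length (filter (λ j → r j <? r i) (allFin n))

  position<n : ∀ i → position i < n
  position<n i = subst (position i <_) (length-tabulate (λ j → j))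
    (filter-notAll (λ j → r j <? r i) (allFin n) (Any.map (λ { refl → <-irrefl refl }) (∈-allFin i)))

  position-mono : ∀ {i j} → r i < r j → position i < position j
  position-mono {i} {j} ri<rj =
    length-filter-mono-< (λ k → r k <? r i) (λ k → r k <? r j) (λ rk<ri → <-trans rk<ri ri<rj)
      (∈-allFin i) (<-irrefl refl) ri<rj

  position-reflects-< : ∀ {i j} → position i < position j → r i < r j
  position-reflects-< {i} {j} pi<pj with <-cmp (r i) (r j)
  ... | tri< ri<rj _ _ = ri<rj
  ... | tri≈ _ ri≡rj _ = contradiction (cong position (r-inj ri≡rj)) (<⇒≢ pi<pj)
  ... | tri> _ _ rj<ri = contradiction (position-mono rj<ri) (<⇒≯ pi<pj)

  position-injective : Injective _≡_ _≡_ position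
  position-injective {i} {j} pi≡pj with <-cmp (r i) (r j)
  ... | tri< ri<rj _ _ = contradiction pi≡pj (<⇒≢ (position-mono ri<rj))
  ... | tri≈ _ ri≡rj _ = r-inj ri≡rj
  ... | tri> _ _ rj<ri = contradiction (sym pi≡pj) (<⇒≢ (position-mono rj<ri))

  positionFin : Fin n → Fin n
  positionFin i = fromℕ< (position<n i)

  toℕ-positionFin : ∀ i → toℕ (positionFin i) ≡ position i
  toℕ-positionFin i = toℕ-fromℕ< (position<n i)

  positionFin-injective : Injective _≡_ _≡_ positionFin
  positionFin-injective {i} {j} eq =
    position-injective (trans (sym (toℕ-positionFin i)) (trans (cong toℕ eq) (toℕ-positionFin j)))

  ordering : Fin n ↔ Fin n
  ordering = injective⇒↔ positionFin positionFin-injective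

addedAsJoin-tabulate : ∀ {L} (f : Fin L → Bool) (c : Fin L) → addedAsJoin (tabulate f) (suc (toℕ c)) ≡ f c
addedAsJoin-tabulate f zero    = refl
addedAsJoin-tabulate f (suc c) = addedAsJoin-tabulate (f ∘ suc) c

module _ {L} (a : Adj (suc L)) (a-sym : Symmetric a) (a-irrefl : Irreflexive a) (b : Fin (suc L) → Bool) where

  ordered⇒threshold : (π : Fin (suc L) ↔ Fin (suc L)) →
    (∀ i j → toℕ (Inverse.to π i) < toℕ (Inverse.to π j) → a i j ≡ b j) → IsThreshold a
  ordered⇒threshold π later = s , iso s (length-tabulate _) (addedAsJoin-tabulate _)
    where
    open Inverse π

    to-injective : Injective _≡_ _≡_ to
    to-injective {i} {j} eq = trans (sym (strictlyInverseʳ i)) (trans (cong from eq) (strictlyInverseʳ j))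

    s : List Bool
    s = tabulate (λ c → b (from (suc c)))

    iso : (s : List Bool) → length s ≡ L → (∀ c → addedAsJoin s (suc (toℕ c)) ≡ b (from (suc c))) →
          Iso a (thrAdj s)
    iso s refl s-bits = π , a≡thrAdj
      where
      bit : ∀ i → 0 < toℕ (to i) → addedAsJoin s (toℕ (to i)) ≡ b i
      bit i 0<i with to i in eq
      ... | suc c = trans (s-bits c) (cong b (trans (cong from (sym eq)) (strictlyInverseʳ i)))

      a≡thrAdj : ∀ i j → a i j ≡ thrAdj s (to i) (to j)
      a≡thrAdj i j with toℕ (to i) <? toℕ (to j) | toℕ (to j) <? toℕ (to i)
      ... | yes i<j | _       = trans (later i j i<j) (sym (bit j (≤-<-trans z≤n i<j)))
      ... | no _    | yes j<i = trans (a-sym i j) (trans (later j i j<i) (sym (bit i (≤-<-trans z≤n j<i))))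
      ... | no i≮j  | no j≮i  with to-injective (toℕ-injective (≤-antisym (≮⇒≥ j≮i) (≮⇒≥ i≮j)))
      ...   | refl = a-irrefl i

  ranked⇒threshold : (r : Fin (suc L) → ℕ) → Injective _≡_ _≡_ r →
    (∀ i j → r i < r j → a i j ≡ b j) → IsThreshold a
  ranked⇒threshold r r-inj later = ordered⇒threshold ordering λ i j i<j →
    later i j (position-reflects-< (subst₂ _<_ (toℕ-positionFin i) (toℕ-positionFin j) i<j))
    where open Position r r-inj

interval≤sum-tabulate : ∀ {n} (f : Fin n → ℕ) a k → a + k ≤ n →
  (∀ i → a ≤ toℕ i → toℕ i < a + k → 1 ≤ f i) → k ≤ sum (tabulate f)
interval≤sum-tabulate f a zero _ _ = z≤n
interval≤sum-tabulate {suc n} f zero (suc k) (s≤s k≤n) pos =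
  +-mono-≤ (pos zero z≤n z<s)
           (interval≤sum-tabulate (f ∘ suc) zero k k≤n λ i _ i<k → pos (suc i) z≤n (s≤s i<k))
interval≤sum-tabulate {suc n} f (suc a) (suc k) (s≤s a+k<n) pos =
  ≤-trans (interval≤sum-tabulate (f ∘ suc) a (suc k) a+k<n
             λ i a≤i i<a+k → pos (suc i) (s≤s a≤i) (s≤s i<a+k))
          (m≤n+m _ (f zero))

module _ (alg : Algorithm) (I : Instance) where
  open Instance I using (n)

  selectedInterval⇒≤numSelected : ∀ a k → a + k ≤ n →
    (∀ i → a ≤ toℕ i → toℕ i < a + k → decision alg I i ≡ true) → k ≤ numSelected alg I
  selectedInterval⇒≤numSelected a k a+k≤n selected =
    subst (k ≤_) (cong sum (sym (map-tabulate (λ i → i) count)))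
      (interval≤sum-tabulate count a k a+k≤n λ i a≤i i<a+k → 1≤count (selected i a≤i i<a+k))
    where
    count : Fin n → ℕ
    count i = if decision alg I i then 1 else 0
    1≤count : ∀ {i} → decision alg I i ≡ true → 1 ≤ count i
    1≤count eq rewrite eq = ≤-refl

does⇒ : ∀ {P : Set} (P? : Dec P) → does P? ≡ true → P
does⇒ (yes p) _ = p

double<odd : ∀ {a b} → a ≤ b → 2 * a < suc (2 * b)
double<odd a≤b = s≤s (*-monoʳ-≤ 2 a≤b)

double<odd⇒≤ : ∀ {a b} → 2 * a < suc (2 * b) → a ≤ b
double<odd⇒≤ 2a<1+2b = *-cancelˡ-≤ 2 (≤-pred 2a<1+2b)

double≢odd : ∀ a b → 2 * a ≢ suc (2 * b)
double≢odd a b eq with ≤-<-connex a b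
... | inj₁ a≤b = <⇒≢ (double<odd a≤b) eq
... | inj₂ b<a = <⇒≢ 1+2b<2a (sym eq)
  where
  open ≤-Reasoning
  1+2b<2a : suc (2 * b) < 2 * a
  1+2b<2a = begin-strict
    suc (2 * b) <⟨ n<1+n _ ⟩
    2 + 2 * b   ≡⟨ *-suc 2 b ⟨
    2 * suc b   ≤⟨ *-monoʳ-≤ 2 b<a ⟩
    2 * a       ∎

1+square≤double-square : ∀ {a s} → 0 < a → a ≤ s → suc (a * a) ≤ (2 * s) ^ 2
1+square≤double-square {a} {s} 0<a a≤s = begin
  suc (a * a)                       ≤⟨ s≤s (*-mono-≤ a≤s a≤s) ⟩
  suc (s * s)                       ≤⟨ +-monoˡ-≤ (s * s) (*-mono-≤ 0<s 0<s) ⟩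
  s * s + s * s                     ≤⟨ m≤m+n (s * s + s * s) (s * s + s * s) ⟩
  (s * s + s * s) + (s * s + s * s) ≡⟨ four-squares s ⟩
  (2 * s) * (2 * s)                 ≡⟨ cong (2 * s *_) (sym (*-identityʳ (2 * s))) ⟩
  (2 * s) ^ 2                       ∎
  where
  open ≤-Reasoning
  0<s : 0 < s
  0<s = <-≤-trans 0<a a≤s
  four-squares : ∀ s → (s * s + s * s) + (s * s + s * s) ≡ (2 * s) * (2 * s)
  four-squares = solve-∀

hubReveal : ℕ → ℕ → Reveal
hubReveal K p = p , upTo (suc (suc p * K))

hubDecision : Algorithm → ℕ → ℕ → Bool
hubDecision alg K p = alg (applyUpTo (hubReveal K) p) (hubReveal K p)

module HubGraph (t′ K : ℕ) (t≤K : suc t′ ≤ K) where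

  t n : ℕ
  t = suc t′
  n = suc (t * K)

  instance
    K-nonZero : NonZero K
    K-nonZero = >-nonZero (<-≤-trans z<s t≤K)

  span : ℕ → ℕ
  span p = suc p * K

  Joined : ℕ → ℕ → Set
  Joined p y = p < t × y ≤ span p

  Edge : ℕ → ℕ → Set
  Edge x y = x ≢ y × (Joined x y ⊎ Joined y x)

  edge? : ∀ x y → Dec (Edge x y)
  edge? x y = ¬? (x ≟ y) ×-dec ((x <? t ×-dec y ≤? span x) ⊎-dec (y <? t ×-dec x ≤? span y))

  edge : ℕ → ℕ → Bool
  edge x y = does (edge? x y)

  open ClosedNeighbourhood n edge

  isHub : ℕ → Bool
  isHub x = does (x <? t)

  edge⇒Edge : ∀ {x y} → edge x y ≡ true → Edge x y
  edge⇒Edge {x} {y} = does⇒ (edge? x y)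

  Edge-sym : ∀ {x y} → Edge x y → Edge y x
  Edge-sym (x≢y , joined) = x≢y ∘ sym , swap joined

  edge-sym : ∀ x y → edge x y ≡ edge y x
  edge-sym x y with edge? x y
  ... | yes e = trans (dec-true (edge? x y) e) (sym (dec-true (edge? y x) (Edge-sym e)))
  ... | no ¬e = trans (dec-false (edge? x y) ¬e) (sym (dec-false (edge? y x) (¬e ∘ Edge-sym)))

  edge-irrefl : ∀ x → edge x x ≡ false
  edge-irrefl x = dec-false (edge? x x) λ (x≢x , _) → x≢x refl

  <t⇒≤span : ∀ {x} p → x < t → x ≤ span p
  <t⇒≤span p x<t = ≤-trans (<⇒≤ (<-≤-trans x<t t≤K)) (m≤m+n K (p * K))

  hub-clique : ∀ {x y} → x < t → y < t → x ≢ y → Edge x y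
  hub-clique {x} x<t y<t x≢y = x≢y , inj₁ (x<t , <t⇒≤span x y<t)

  leaf-neighbour : ∀ {x y} → t′ * K < y → Edge x y → x ≡ t′
  leaf-neighbour {x} t′K<y (_ , inj₁ (x<t , y≤span)) with m<1+n⇒m<n∨m≡n x<t
  ... | inj₁ x<t′ = contradiction (*-monoˡ-≤ K x<t′) (<⇒≱ (<-≤-trans t′K<y y≤span))
  ... | inj₂ x≡t′ = x≡t′
  leaf-neighbour t′K<y (_ , inj₂ (y<t , _)) =
    contradiction (≤-trans (≤-pred y<t) (m≤m*n t′ K)) (<⇒≱ t′K<y)

  hub-nbhd : ∀ {p} → p < t → nbhd p ≡ upTo (suc (span p))
  hub-nbhd {p} p<t = filter-upTo (closed? p) n (s≤s (*-monoˡ-≤ K p<t)) sound complete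
    where
    sound : ∀ {y} → y < n → Closed p y → y < suc (span p)
    sound _ (inj₁ refl) = s≤s (<t⇒≤span p p<t)
    sound _ (inj₂ e) with edge⇒Edge {p} e
    ... | _ , inj₁ (_ , y≤span) = s≤s y≤span
    ... | _ , inj₂ (y<t , _)    = s≤s (<t⇒≤span p y<t)
    complete : ∀ {y} → y < suc (span p) → Closed p y
    complete {y} (s≤s y≤span) with p ≟ y
    ... | yes p≡y = inj₁ p≡y
    ... | no p≢y  = inj₂ (dec-true (edge? p y) (p≢y , inj₁ (p<t , y≤span)))

  lastHub : Fin n
  lastHub = fromℕ< (≤-trans (m≤m*n t K) (n≤1+n (t * K)))

  toℕ-lastHub : toℕ lastHub ≡ t′
  toℕ-lastHub = toℕ-fromℕ< _

  Edge-lastHub : ∀ {y} → t ≤ y → y < n → Edge t′ y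
  Edge-lastHub t≤y y<n = <⇒≢ t≤y , inj₁ (≤-refl , ≤-pred y<n)

  earlier-neighbour : ∀ v → 0 < toℕ v → Σ (Fin n) λ w → toℕ w < toℕ v × adj w v ≡ true
  earlier-neighbour v 0<v with toℕ v <? t
  ... | yes v<t = zero , 0<v , dec-true (edge? 0 (toℕ v)) (<⇒≢ 0<v , inj₁ (z<s , <t⇒≤span 0 v<t))
  ... | no v≮t  = lastHub , subst (λ w → w < toℕ v × edge w (toℕ v) ≡ true) (sym toℕ-lastHub)
                    (≮⇒≥ v≮t , dec-true (edge? t′ (toℕ v)) (Edge-lastHub (≮⇒≥ v≮t) (toℕ<n v)))

  -- Hub p comes right after the leaves it is joined to; the parities keep hubs and leaves apart.
  rank : ℕ → ℕ
  rank x = if isHub x then suc (2 * span x) else 2 * x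

  rank-hub : ∀ {x} → x < t → rank x ≡ suc (2 * span x)
  rank-hub {x} x<t rewrite dec-true (x <? t) x<t = refl

  rank-leaf : ∀ {x} → ¬ x < t → rank x ≡ 2 * x
  rank-leaf {x} x≮t rewrite dec-false (x <? t) x≮t = refl

  span-injective : ∀ {x y} → span x ≡ span y → x ≡ y
  span-injective {x} {y} eq = suc-injective (*-cancelʳ-≡ (suc x) (suc y) K eq)

  rank-injective : ∀ {x y} → rank x ≡ rank y → x ≡ y
  rank-injective {x} {y} eq with x <? t | y <? t
  ... | yes x<t | yes y<t =
    span-injective (*-cancelˡ-≡ _ _ 2 (suc-injective (subst₂ _≡_ (rank-hub x<t) (rank-hub y<t) eq)))
  ... | no x≮t  | no y≮t  = *-cancelˡ-≡ x y 2 (subst₂ _≡_ (rank-leaf x≮t) (rank-leaf y≮t) eq)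
  ... | yes x<t | no y≮t  = contradiction (subst₂ _≡_ (rank-leaf y≮t) (rank-hub x<t) (sym eq)) (double≢odd y (span x))
  ... | no x≮t  | yes y<t = contradiction (subst₂ _≡_ (rank-leaf x≮t) (rank-hub y<t) eq) (double≢odd x (span y))

  edge-by-rank : ∀ x y → rank x < rank y → edge x y ≡ isHub y
  edge-by-rank x y rx<ry with x <? t | y <? t
  ... | yes x<t | yes y<t = trans (dec-true (edge? x y) (hub-clique x<t y<t λ { refl → <-irrefl refl rx<ry }))
                                  (sym (dec-true (y <? t) y<t))
  ... | no x≮t  | no y≮t  = trans (dec-false (edge? x y) λ { (_ , inj₁ (x<t , _)) → x≮t x<t
                                                           ; (_ , inj₂ (y<t , _)) → y≮t y<t })
                                  (sym (dec-false (y <? t) y≮t))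
  ... | yes x<t | no y≮t  = trans (dec-false (edge? x y) λ { (_ , inj₁ (_ , y≤span)) → <-asym rx<ry (ry<rx y≤span)
                                                           ; (_ , inj₂ (y<t , _)) → y≮t y<t })
                                  (sym (dec-false (y <? t) y≮t))
    where
    ry<rx : y ≤ span x → rank y < rank x
    ry<rx y≤span = subst₂ _<_ (sym (rank-leaf y≮t)) (sym (rank-hub x<t)) (double<odd y≤span)
  ... | no x≮t  | yes y<t = trans (dec-true (edge? x y) (x≢y , inj₂ (y<t , x≤span)))
                                  (sym (dec-true (y <? t) y<t))
    where
    x≢y : x ≢ y
    x≢y refl = x≮t y<t
    x≤span : x ≤ span y
    x≤span = double<odd⇒≤ (subst₂ _<_ (rank-leaf x≮t) (rank-hub y<t) rx<ry)

  adj-sym : Symmetric adj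
  adj-sym i j = edge-sym (toℕ i) (toℕ j)

  adj-irrefl : Irreflexive adj
  adj-irrefl i = edge-irrefl (toℕ i)

  isThreshold : IsThreshold adj
  isThreshold = ranked⇒threshold adj adj-sym adj-irrefl (isHub ∘ toℕ) (rank ∘ toℕ)
    (toℕ-injective ∘ rank-injective) (λ i j → edge-by-rank (toℕ i) (toℕ j))

  graph : Instance
  graph = record
    { n          = n
    ; adj        = adj
    ; sym        = adj-sym
    ; irrefl     = adj-irrefl
    ; admissible = earlierNeighbours⇒admissible adj-sym earlier-neighbour
    ; name       = toℕ
    ; name-inj   = λ _ _ → toℕ-injective
    ; nbhd       = nbhd ∘ toℕ
    ; nbhd-ok    = nbhd-correct
    }

  K≤n : K ≤ n
  K≤n = m≤n⇒m≤1+n (m≤m+n K (t′ * K))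

  n≤1+K² : n ≤ suc (K * K)
  n≤1+K² = s≤s (*-monoˡ-≤ K t≤K)

  hub-decision : ∀ alg (i : Fin n) → toℕ i < t → decision alg graph i ≡ hubDecision alg K (toℕ i)
  hub-decision alg i i<t = cong₂ alg
    (take-tabulate (λ x → x , nbhd x) (hubReveal K) (<⇒≤ (toℕ<n i))
                   (λ x<i → cong (_ ,_) (hub-nbhd (<-trans x<i i<t))))
    (cong (toℕ i ,_) (hub-nbhd i<t))

  allHubsSelected⇒t≤numSelected : ∀ alg → (∀ {p} → p < t → hubDecision alg K p ≡ true) →
    t ≤ numSelected alg graph
  allHubsSelected⇒t≤numSelected alg selected =
    selectedInterval⇒≤numSelected alg graph 0 t (≤-trans t≤K K≤n)
      λ i _ i<t → trans (hub-decision alg i i<t) (selected i<t)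

  lastHubUnselected⇒K≤numSelected : ∀ alg → Valid alg → hubDecision alg K t′ ≡ false →
    K ≤ numSelected alg graph
  lastHubUnselected⇒K≤numSelected alg valid unselected =
    selectedInterval⇒≤numSelected alg graph (suc (t′ * K)) K
      (≤-reflexive (cong suc (+-comm (t′ * K) K))) λ i t′K<i _ → leafSelected i t′K<i
    where
    lastHub-unselected : ∀ u → toℕ u ≡ t′ → decision alg graph u ≡ false
    lastHub-unselected u u≡t′ = begin
      decision alg graph u      ≡⟨ hub-decision alg u (≤-reflexive (cong suc u≡t′)) ⟩
      hubDecision alg K (toℕ u) ≡⟨ cong (hubDecision alg K) u≡t′ ⟩
      hubDecision alg K t′      ≡⟨ unselected ⟩
      false                     ∎
      where open ≡-Reasoning

    leafSelected : ∀ i → t′ * K < toℕ i → decision alg graph i ≡ true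
    leafSelected i t′K<i with valid graph i
    ... | u , selected , inj₁ refl = selected
    ... | u , selected , inj₂ e    =
      contradiction (trans (sym selected) (lastHub-unselected u (leaf-neighbour t′K<i (edge⇒Edge e)))) λ ()

adversary : ∀ alg → Valid alg → ∀ m → Σ Instance λ I →
  IsThreshold (Instance.adj I) × suc m ≤ Instance.n I × Instance.n I ≤ suc (suc m * suc m) ×
  suc m ≤ numSelected alg I
adversary alg valid m with anyUpTo? (λ p → hubDecision alg (suc m) p Bool.≟ false) (suc m)
... | yes (p , p<K , unselected) =
  graph , isThreshold , K≤n , n≤1+K² , lastHubUnselected⇒K≤numSelected alg valid unselected
  where open HubGraph p (suc m) p<K
... | no noneUnselected =
  graph , isThreshold , K≤n , n≤1+K² ,
  allHubsSelected⇒t≤numSelected alg λ {p} p<K → ¬-not λ eq → noneUnselected (p , p<K , eq)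
  where open HubGraph m (suc m) ≤-refl

theorem9 : (alg : Algorithm) → Valid alg →
  Σ ℕ λ c → (m : ℕ) → Σ Instance λ I →
    m ≤ Instance.n I × IsThreshold (Instance.adj I) ×
    Instance.n I ≤ (c * numSelected alg I) ^ 2
theorem9 alg valid = 2 , λ m →
  let I , threshold , K≤n , n≤1+K² , K≤selected = adversary alg valid m
  in I , <⇒≤ K≤n , threshold , ≤-trans n≤1+K² (1+square≤double-square z<s K≤selected)
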